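{- Let $\mathcal{G}=(H,\sigma,\alpha,h_0)$ be a rooted combinatorial map with root-vertex $v_0$, and let $S$ be a subgraph. The orientation $\mathcal{O}_S=\Phi(S)$ is $v_0$-connected if and only if $S$ is connected.
   Context: A rooted combinatorial map is $\mathcal{G}=(H,\sigma,\alpha,h_0)$ with $H$ a finite set of half-edges, $\sigma$ a permutation, $\alpha$ a fixed-point-free involution, $\langle\sigma,\alpha\rangle$ transitive on $H$, root $h_0$; its underlying graph $G=(V,E)$ has the cycles of $\sigma$ as vertices and the pairs $\{h,\alpha(h)\}$ as edges; the root-vertex $v_0$ is the vertex containing $h_0$. Subgraphs are spanning and identified with edge sets; $S$ connected means $(V,S)$ is connected. An orientation assigns to each edge $\{h,h'\}$ an ordered pair $(h,h')$ (tail $h$, head $h'$, arc from the vertex of $h$ to that of $h'$); it is $v_0$-connected if every vertex is reachable from $v_0$ by a directed path. For a spanning tree $T$: edges in $T$ are internal, others external; the motion function $t(h)=\sigma\alpha(h)$ if the edge of $h$ is internal, $\sigma(h)$ otherwise, is a cyclic permutation of $H$; the $(\mathcal{G},T)$-order on $H$ is $h_0<t(h_0)<\dots<t^{|H|-1}(h_0)$, edges compared via their smaller half-edge. The fundamental cycle of an external $e$ is the set of $e'$ with $T-e'+e$ a spanning tree; the fundamental cocycle of an internal $e$ is the set of $e'$ with $T-e+e'$ a spanning tree; an edge is $(\mathcal{G},T)$-active if minimal in its fundamental cycle/cocycle. $[T^-,T^+]$ is the set of subgraphs obtained from $T$ by removing some internal active edges and adding some external active edges; every subgraph lies in exactly one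 such tree-interval. $\Phi(S)$ for $S\in[T^-,T^+]$: for $e=\{h_1,h_2\}$ with $h_1<h_2$, $\Phi(S)(e)=(h_1,h_2)$ if either ($e\in T$ and its fundamental cocycle contains no edge of $S\triangle T$) or ($e\notin T$ and its fundamental cycle contains some edge of $S\triangle T$); otherwise $(h_2,h_1)$. -}

module Defs where

open import Data.Nat using (ℕ; zero; suc; _<_)
open import Data.Fin using (Fin; _≟_)
open import Data.Bool using (Bool; true; false; if_then_else_; _∨_)
open import Data.Product using (Σ; ∃; _×_; _,_)
open import Data.Sum using (_⊎_)
open import Relation.Nullary using (¬_)
open import Relation.Nullary.Decidable using (⌊_⌋)
open import Relation.Binary.PropositionalEquality using (_≡_; _≢_)
open import Relation.Binary.Construct.Closure.ReflexiveTransitive using (Star)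

iter : ∀ {A : Set} → (A → A) → ℕ → A → A
iter f zero    x = x
iter f (suc k) x = f (iter f k x)

record RootedMap (n : ℕ) : Set where
  field
    σ     : Fin n → Fin n
    σ⁻¹   : Fin n → Fin n
    σ∘σ⁻¹ : ∀ h → σ (σ⁻¹ h) ≡ h
    σ⁻¹∘σ : ∀ h → σ⁻¹ (σ h) ≡ h
    α     : Fin n → Fin n
    α-inv : ∀ h → α (α h) ≡ h
    α-fpf : ∀ h → α h ≢ h
    transitive : ∀ h h' → Star (λ x y → (y ≡ σ x ⊎ x ≡ σ y) ⊎ y ≡ α x) h h'
    h₀    : Fin n

module _ {n : ℕ} (M : RootedMap n) where
  open RootedMap M

  -- a subgraph is a set of edges, represented as an α-invariant
  -- Boolean predicate on half-edges
  IsSubgraph : (Fin n → Bool) → Set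
  IsSubgraph S = ∀ h → S (α h) ≡ S h

  onEdge : Fin n → Fin n → Bool
  onEdge x e = ⌊ x ≟ e ⌋ ∨ ⌊ x ≟ α e ⌋

  removeE : (Fin n → Bool) → Fin n → (Fin n → Bool)
  removeE S e x = if onEdge x e then false else S x

  addE : (Fin n → Bool) → Fin n → (Fin n → Bool)
  addE S e x = if onEdge x e then true else S x

  -- undirected step in (V,S): move around a vertex (σ-cycle), or cross an edge of S
  UStep : (Fin n → Bool) → Fin n → Fin n → Set
  UStep S x y = y ≡ σ x ⊎ (S x ≡ true × y ≡ α x)

  Connected : (Fin n → Bool) → Set
  Connected S = ∀ h → Star (UStep S) h₀ h

  -- spanning tree = minimally connected spanning subgraph
  IsSpanningTree : (Fin n → Bool) → Set
  IsSpanningTree T = IsSubgraph T × Connected T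
                   × (∀ e → T e ≡ true → ¬ Connected (removeE T e))

  motion : (Fin n → Bool) → Fin n → Fin n
  motion T h = if T h then σ (α h) else σ h

  -- the (G,T)-order: h₀ < t(h₀) < … < t^{|H|-1}(h₀)
  Before : (Fin n → Bool) → Fin n → Fin n → Set
  Before T h h' = Σ ℕ λ k → Σ ℕ λ k' → k < k' × k' < n
                  × iter (motion T) k h₀ ≡ h × iter (motion T) k' h₀ ≡ h'

  -- edge of e' is smaller than edge of e (comparison via smaller half-edges)
  EdgeLess : (Fin n → Bool) → Fin n → Fin n → Set
  EdgeLess T e' e = Σ (Fin n) λ x → (x ≡ e' ⊎ x ≡ α e')
                    × Before T x e × Before T x (α e)

  -- e' in the fundamental cycle of external e : T + e - e' spanning tree
  InFundCycle : (Fin n → Bool) → Fin n → Fin n → Set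
  InFundCycle T e e' = IsSpanningTree (removeE (addE T e) e')

  -- e' in the fundamental cocycle of internal e : T - e + e' spanning tree
  InFundCocycle : (Fin n → Bool) → Fin n → Fin n → Set
  InFundCocycle T e e' = IsSpanningTree (addE (removeE T e) e')

  Active : (Fin n → Bool) → Fin n → Set
  Active T e = (T e ≡ true  → ∀ e' → InFundCocycle T e e' → ¬ EdgeLess T e' e)
             × (T e ≡ false → ∀ e' → InFundCycle T e e' → ¬ EdgeLess T e' e)

  -- S ∈ [T⁻, T⁺]: S differs from T only on active edges
  InInterval : (Fin n → Bool) → (Fin n → Bool) → Set
  InInterval T S = ∀ e → S e ≢ T e → Active T e

  -- condition deciding whether Φ(S)(e) = (h₁,h₂) with h₁ < h₂
  ΦCond : (Fin n → Bool) → (Fin n → Bool) → Fin n → Set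
  ΦCond T S e = (T e ≡ true  × (∀ e' → InFundCocycle T e e' → S e' ≡ T e'))
              ⊎ (T e ≡ false × (Σ (Fin n) λ e' → InFundCycle T e e' × S e' ≢ T e'))

  ΦTail : (Fin n → Bool) → (Fin n → Bool) → Fin n → Set
  ΦTail T S h = (Before T h (α h) × ΦCond T S h)
              ⊎ (Before T (α h) h × ¬ ΦCond T S h)

  ΦStep : (Fin n → Bool) → (Fin n → Bool) → Fin n → Fin n → Set
  ΦStep T S x y = y ≡ σ x ⊎ (ΦTail T S x × y ≡ α x)

  ΦRootConnected : (Fin n → Bool) → (Fin n → Bool) → Set
  ΦRootConnected T S = ∀ h → Star (ΦStep T S) h₀ h

{-# OPTIONS --safe #-}
-- The motion function of a spanning tree T is its contour walk: from h₀ it visits every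
-- half-edge exactly once, so the (G,T)-order is the order of visit, and every tree edge is
-- traversed first away from the root, through its "downward" half-edge a, and later back
-- through α a.  The half-edges visited after a and up to α a are exactly those cut off from h₀
-- when a is removed from T.  Hence the fundamental cocycle of a consists of a and the external
-- edges crossing this interval, and a lies in the fundamental cycle of each of them.
--
-- If S omits a tree edge a, nothing leaves the root side of the cut of a: an external edge of
-- S crossing it would be active together with a, yet the larger of the two is not minimal in
-- its fundamental cycle or cocycle, which contains the other; an arc of Φ(S) entering the cut
-- would either contradict the rule defining Φ or make a inactive.  So S is disconnected and
-- Φ(S) is not root-connected.
-- If S contains T, S is connected, and Φ(S) reaches the half-edges in tour order: the only
-- obstacle is a tree edge oriented towards the root, and then a changed external edge crossing
-- its cut leads below it, from where the tree edges oriented towards the root lead back up.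

module Submission where

open import Defs
open import Data.Nat using (ℕ; zero; suc; _+_; _*_; _∸_; _<_; _≤_; _≤?_; _<?_; z≤n; NonZero)
open import Data.Nat.Properties
  using (≤-refl; ≤-trans; <-trans; ≤-<-trans; <-≤-trans; <⇒≤; ≤-pred; <-irrefl; <-asym; ≤-antisym; <-cmp; ≮⇒≥; ≰⇒>;
         n<1+n; n≤1+n; m≤n⇒m<n∨m≡n; +-comm; *-comm; m∸n≤m; m>n⇒m∸n≢0; m+[n∸m]≡n)
open import Data.Nat.DivMod using (_%_; _/_; m≡m%n+[m/n]*n; m%n<n)
open import Data.Fin using (Fin; toℕ; fromℕ<; _≟_)
open import Data.Fin.Properties using (pigeonhole; toℕ-fromℕ<; toℕ<n; any?)
open import Data.Bool using (Bool; true; false; if_then_else_; not; _∨_)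
open import Data.Bool.Properties using (¬-not) renaming (_≟_ to _≟ᵇ_)
open import Data.Product using (∃; _×_; _,_; proj₁; proj₂)
open import Data.Empty using (⊥)
open import Data.Sum using (_⊎_; inj₁; inj₂; map₂)
open import Relation.Nullary using (¬_; Dec; does; proof; yes; no; contradiction)
open import Relation.Nullary.Reflects using (Reflects; invert)
open import Relation.Nullary.Decidable
  using (dec-true; dec-false; isYes≗does; _⊎-dec_; _×-dec_; ¬?; decidable-stable; ¬¬-excluded-middle)
open import Relation.Binary.Definitions using (_Respects_; tri<; tri≈; tri>)
open import Relation.Binary.PropositionalEquality
open import Relation.Binary.Construct.Closure.ReflexiveTransitive using (Star; ε; _◅_; _◅◅_) renaming (map to Star-map)
open import Function.Base using (_∘_)
open import Function.Bundles using (_⇔_; mk⇔)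

open ≡-Reasoning

iter-+ : ∀ {A : Set} (f : A → A) m k x → iter f (m + k) x ≡ iter f m (iter f k x)
iter-+ f zero    k x = refl
iter-+ f (suc m) k x = cong f (iter-+ f m k x)


Star-iter : ∀ {A : Set} {R : A → A → Set} (f : A → A) → (∀ x → R x (f x)) →
            ∀ k x → Star R x (iter f k x)
Star-iter f step zero    x = ε
Star-iter f step (suc k) x = Star-iter f step k x ◅◅ (step _ ◅ ε)

Star-preserves : ∀ {A : Set} {R : A → A → Set} {P : A → Set} → P Respects R → P Respects Star R
Star-preserves step ε        p = p
Star-preserves step (r ◅ rs) p = Star-preserves step rs (step r p)

module Orbit {n : ℕ} {f : Fin n → Fin n} (f-injective : ∀ {x y} → f x ≡ f y → x ≡ y) where

  iter-injective : ∀ k {x y} → iter f k x ≡ iter f k y → x ≡ y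
  iter-injective zero    eq = eq
  iter-injective (suc k) eq = iter-injective k (f-injective eq)

  iter-gap : ∀ {i j} x → i ≤ j → iter f i x ≡ iter f j x → iter f (j ∸ i) x ≡ x
  iter-gap {i} {j} x i≤j eq = iter-injective i (begin
    iter f i (iter f (j ∸ i) x)  ≡⟨ iter-+ f i (j ∸ i) x ⟨
    iter f (i + (j ∸ i)) x       ≡⟨ cong (λ m → iter f m x) (m+[n∸m]≡n i≤j) ⟩
    iter f j x                   ≡⟨ eq ⟨
    iter f i x                   ∎)

  cycle-from-repeat : ∀ {i j} x → i < j → iter f i x ≡ iter f j x →
                      ∃ λ p → suc p ≤ j × iter f (suc p) x ≡ x
  cycle-from-repeat {i} {j} x i<j eq with j ∸ i in gap
  ... | zero  = contradiction gap (m>n⇒m∸n≢0 i<j)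
  ... | suc p = p , subst (_≤ j) gap (m∸n≤m j i)
                  , subst (λ d → iter f d x ≡ x) gap (iter-gap x (<⇒≤ i<j) eq)

  period : ∀ x → ∃ λ p → suc p ≤ n × iter f (suc p) x ≡ x
  period x with i , j , i<j , eq ← pigeonhole (n<1+n n) (λ (i : Fin (suc n)) → iter f (toℕ i) x)
    with p , p<j , cyc ← cycle-from-repeat x i<j eq
    = p , ≤-trans p<j (≤-pred (toℕ<n j)) , cyc

  iter-*-period : ∀ {d x} → iter f d x ≡ x → ∀ q → iter f (q * d) x ≡ x
  iter-*-period         cyc zero    = refl
  iter-*-period {d} {x} cyc (suc q) = begin
    iter f (d + q * d) x       ≡⟨ iter-+ f d (q * d) x ⟩
    iter f d (iter f (q * d) x) ≡⟨ cong (iter f d) (iter-*-period cyc q) ⟩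
    iter f d x                 ≡⟨ cyc ⟩
    x                          ∎

  iter-%-period : ∀ {d x} .{{_ : NonZero d}} → iter f d x ≡ x → ∀ k → iter f (k % d) x ≡ iter f k x
  iter-%-period {d} {x} cyc k = sym (begin
    iter f k x                               ≡⟨ cong (λ m → iter f m x) (m≡m%n+[m/n]*n k d) ⟩
    iter f (k % d + (k / d) * d) x           ≡⟨ iter-+ f (k % d) ((k / d) * d) x ⟩
    iter f (k % d) (iter f ((k / d) * d) x)  ≡⟨ cong (iter f (k % d)) (iter-*-period cyc (k / d)) ⟩
    iter f (k % d) x                         ∎)

  iter-reverse : ∀ {x y} k → iter f k x ≡ y → ∃ λ k' → iter f k' y ≡ x
  iter-reverse {x} {y} k eq with p , _ , cyc ← period x = p * k , (begin
    iter f (p * k) y             ≡⟨ cong (iter f (p * k)) eq ⟨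
    iter f (p * k) (iter f k x)  ≡⟨ iter-+ f (p * k) k x ⟨
    iter f (p * k + k) x         ≡⟨ cong (λ m → iter f m x) (+-comm (p * k) k) ⟩
    iter f (suc p * k) x         ≡⟨ cong (λ m → iter f m x) (*-comm (suc p) k) ⟩
    iter f (k * suc p) x         ≡⟨ iter-*-period cyc k ⟩
    x                            ∎)

  iter-bounded : ∀ {x y} k → iter f k x ≡ y → ∃ λ k' → k' < n × iter f k' x ≡ y
  iter-bounded {x} k eq with p , p<n , cyc ← period x =
    k % suc p , ≤-trans (m%n<n k (suc p)) p<n , trans (iter-%-period cyc k) eq

  module Enumeration (x₀ : Fin n) (covers : ∀ y → ∃ λ k → iter f k x₀ ≡ y) where

    orbit-within-period : ∀ {p} → iter f (suc p) x₀ ≡ x₀ →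
                          ∀ y → ∃ λ (r : Fin (suc p)) → iter f (toℕ r) x₀ ≡ y
    orbit-within-period {p} cyc y with k , iter-k ← covers y =
      fromℕ< (m%n<n k (suc p)) , (begin
        iter f (toℕ (fromℕ< (m%n<n k (suc p)))) x₀  ≡⟨ cong (λ m → iter f m x₀) (toℕ-fromℕ< (m%n<n k (suc p))) ⟩
        iter f (k % suc p) x₀                       ≡⟨ iter-%-period cyc k ⟩
        iter f k x₀                                 ≡⟨ iter-k ⟩
        y                                           ∎)

    iter-injective-below : ∀ {i j} → i < j → j < n → iter f i x₀ ≢ iter f j x₀
    iter-injective-below i<j j<n eq with p , p<j , cyc ← cycle-from-repeat x₀ i<j eq
      with y , y' , y<y' , same ← pigeonhole (≤-<-trans p<j j<n) (λ y → proj₁ (orbit-within-period cyc y))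
      = <-irrefl (cong toℕ (begin
          y                                                      ≡⟨ proj₂ (orbit-within-period cyc y) ⟨
          iter f (toℕ (proj₁ (orbit-within-period cyc y))) x₀    ≡⟨ cong (λ r → iter f (toℕ r) x₀) same ⟩
          iter f (toℕ (proj₁ (orbit-within-period cyc y'))) x₀   ≡⟨ proj₂ (orbit-within-period cyc y') ⟩
          y'                                                     ∎)) y<y'

    opaque
      index : Fin n → ℕ
      index y = proj₁ (iter-bounded (proj₁ (covers y)) (proj₂ (covers y)))

      index<n : ∀ y → index y < n
      index<n y = proj₁ (proj₂ (iter-bounded (proj₁ (covers y)) (proj₂ (covers y))))

      iter-index : ∀ y → iter f (index y) x₀ ≡ y
      iter-index y = proj₂ (proj₂ (iter-bounded (proj₁ (covers y)) (proj₂ (covers y))))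

    index-iter : ∀ {k} → k < n → index (iter f k x₀) ≡ k
    index-iter {k} k<n with <-cmp (index (iter f k x₀)) k
    ... | tri< i<k _ _ = contradiction (iter-index _) (iter-injective-below i<k k<n)
    ... | tri≈ _ i≡k _ = i≡k
    ... | tri> _ _ k<i = contradiction (sym (iter-index _)) (iter-injective-below k<i (index<n _))

    index-injective : ∀ {x y} → index x ≡ index y → x ≡ y
    index-injective {x} {y} eq = begin
      x                   ≡⟨ iter-index x ⟨
      iter f (index x) x₀ ≡⟨ cong (λ m → iter f m x₀) eq ⟩
      iter f (index y) x₀ ≡⟨ iter-index y ⟩
      y                   ∎

module MapBasics {n : ℕ} (M : RootedMap n) where
  open RootedMap M

  σ-injective : ∀ {x y} → σ x ≡ σ y → x ≡ y
  σ-injective {x} {y} eq = trans (sym (σ⁻¹∘σ x)) (trans (cong σ⁻¹ eq) (σ⁻¹∘σ y))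

  α-injective : ∀ {x y} → α x ≡ α y → x ≡ y
  α-injective {x} {y} eq = trans (sym (α-inv x)) (trans (cong α eq) (α-inv y))

  SameEdge : Fin n → Fin n → Set
  SameEdge x e = x ≡ e ⊎ x ≡ α e

  SameEdge? : ∀ x e → Dec (SameEdge x e)
  SameEdge? x e = (x ≟ e) ⊎-dec (x ≟ α e)

  SameEdge-α : ∀ {x e} → SameEdge x e → SameEdge (α x) e
  SameEdge-α (inj₁ refl) = inj₂ refl
  SameEdge-α (inj₂ refl) = inj₁ (α-inv _)

  SameEdge-α⁻¹ : ∀ {x e} → SameEdge (α x) e → SameEdge x e
  SameEdge-α⁻¹ {x} o = subst (λ z → SameEdge z _) (α-inv x) (SameEdge-α o)

  SameEdge-sym : ∀ {x e} → SameEdge x e → SameEdge e x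
  SameEdge-sym (inj₁ refl) = inj₁ refl
  SameEdge-sym (inj₂ refl) = inj₂ (sym (α-inv _))

  SameEdge-trans : ∀ {x e g} → SameEdge x e → SameEdge e g → SameEdge x g
  SameEdge-trans (inj₁ refl) o = o
  SameEdge-trans (inj₂ refl) o = SameEdge-α o

  subgraph-on-edge : ∀ {S} → IsSubgraph M S → ∀ {x e} → SameEdge x e → S x ≡ S e
  subgraph-on-edge sub (inj₁ refl) = refl
  subgraph-on-edge sub (inj₂ refl) = sub _

  onEdge-true : ∀ {x e} → SameEdge x e → onEdge M x e ≡ true
  onEdge-true {x} {e} o =
    trans (cong₂ _∨_ (isYes≗does (x ≟ e)) (isYes≗does (x ≟ α e))) (dec-true (SameEdge? x e) o)

  onEdge-false : ∀ {x e} → ¬ SameEdge x e → onEdge M x e ≡ false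
  onEdge-false {x} {e} o =
    trans (cong₂ _∨_ (isYes≗does (x ≟ e)) (isYes≗does (x ≟ α e))) (dec-false (SameEdge? x e) o)

  module _ (S : Fin n → Bool) {e x : Fin n} where

    removeE-on : SameEdge x e → removeE M S e x ≡ false
    removeE-on o = cong (if_then false else S x) (onEdge-true o)

    removeE-off : ¬ SameEdge x e → removeE M S e x ≡ S x
    removeE-off o = cong (if_then false else S x) (onEdge-false o)

    addE-on : SameEdge x e → addE M S e x ≡ true
    addE-on o = cong (if_then true else S x) (onEdge-true o)

    addE-off : ¬ SameEdge x e → addE M S e x ≡ S x
    addE-off o = cong (if_then true else S x) (onEdge-false o)

    removeE-true : removeE M S e x ≡ true → ¬ SameEdge x e × S x ≡ true
    removeE-true p with SameEdge? x e
    ... | yes o = contradiction (trans (sym p) (removeE-on o)) λ ()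
    ... | no o  = o , trans (sym (removeE-off o)) p

    addE-true : addE M S e x ≡ true → SameEdge x e ⊎ S x ≡ true
    addE-true p with SameEdge? x e
    ... | yes o = inj₁ o
    ... | no o  = inj₂ (trans (sym (addE-off o)) p)

  addE-⊇ : ∀ S e x → S x ≡ true → addE M S e x ≡ true
  addE-⊇ S e x Sx with SameEdge? x e
  ... | yes o = addE-on S o
  ... | no o  = trans (addE-off S o) Sx

  removeE-cong : ∀ {S S'} e → S ≗ S' → removeE M S e ≗ removeE M S' e
  removeE-cong e eq x = cong (if onEdge M x e then false else_) (eq x)

  addE-cong : ∀ {S S'} e → S ≗ S' → addE M S e ≗ addE M S' e
  addE-cong e eq x = cong (if onEdge M x e then true else_) (eq x)

  removeE-edge-cong : ∀ S {c e} → SameEdge c e → removeE M S c ≗ removeE M S e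
  removeE-edge-cong S {e = e} c~e x with SameEdge? x e
  ... | yes o = trans (removeE-on S (SameEdge-trans o (SameEdge-sym c~e))) (sym (removeE-on S o))
  ... | no o  = trans (removeE-off S (λ o' → o (SameEdge-trans o' c~e))) (sym (removeE-off S o))

  onEdge-α : ∀ x e → onEdge M (α x) e ≡ onEdge M x e
  onEdge-α x e with SameEdge? x e
  ... | yes o = trans (onEdge-true (SameEdge-α o)) (sym (onEdge-true o))
  ... | no o  = trans (onEdge-false (o ∘ SameEdge-α⁻¹)) (sym (onEdge-false o))

  removeE-subgraph : ∀ {S} e → IsSubgraph M S → IsSubgraph M (removeE M S e)
  removeE-subgraph e sub x = cong₂ (if_then false else_) (onEdge-α x e) (sub x)

  addE-subgraph : ∀ {S} e → IsSubgraph M S → IsSubgraph M (addE M S e)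
  addE-subgraph e sub x = cong₂ (if_then true else_) (onEdge-α x e) (sub x)

  addE-present : ∀ {S e} → IsSubgraph M S → S e ≡ true → addE M S e ≗ S
  addE-present {S} {e} sub Se x with SameEdge? x e
  ... | yes o = trans (addE-on S o) (sym (trans (subgraph-on-edge sub o) Se))
  ... | no o  = addE-off S o


  addE-removeE : ∀ {S e} → IsSubgraph M S → S e ≡ true → addE M (removeE M S e) e ≗ S
  addE-removeE {S} {e} sub Se x with SameEdge? x e
  ... | yes o = trans (addE-on (removeE M S _) o) (sym (trans (subgraph-on-edge sub o) Se))
  ... | no o  = trans (addE-off (removeE M S _) o) (removeE-off S o)

  removeE-addE : ∀ {S e} → IsSubgraph M S → S e ≡ false → removeE M (addE M S e) e ≗ S
  removeE-addE {S} {e} sub Se x with SameEdge? x e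
  ... | yes o = trans (removeE-on (addE M S _) o) (sym (trans (subgraph-on-edge sub o) Se))
  ... | no o  = trans (removeE-off (addE M S _) o) (addE-off S o)

  removeE-addE-comm : ∀ S {g e} → ¬ SameEdge g e → removeE M (addE M S g) e ≗ addE M (removeE M S e) g
  removeE-addE-comm S {g} {e} g≁e x with SameEdge? x e | SameEdge? x g
  ... | yes oe | yes og = contradiction (SameEdge-trans (SameEdge-sym og) oe) g≁e
  ... | yes oe | no og  = begin
    removeE M (addE M S g) e x  ≡⟨ removeE-on (addE M S g) oe ⟩
    false                       ≡⟨ removeE-on S oe ⟨
    removeE M S e x             ≡⟨ addE-off (removeE M S e) og ⟨
    addE M (removeE M S e) g x  ∎
  ... | no oe  | yes og = begin
    removeE M (addE M S g) e x  ≡⟨ removeE-off (addE M S g) oe ⟩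
    addE M S g x                ≡⟨ addE-on S og ⟩
    true                        ≡⟨ addE-on (removeE M S e) og ⟨
    addE M (removeE M S e) g x  ∎
  ... | no oe  | no og  = begin
    removeE M (addE M S g) e x  ≡⟨ removeE-off (addE M S g) oe ⟩
    addE M S g x                ≡⟨ addE-off S og ⟩
    S x                         ≡⟨ removeE-off S oe ⟨
    removeE M S e x             ≡⟨ addE-off (removeE M S e) og ⟨
    addE M (removeE M S e) g x  ∎

  Reach : (Fin n → Bool) → Fin n → Fin n → Set
  Reach S = Star (UStep M S)

  Reach-σ^ : ∀ S k x → Reach S x (iter σ k x)
  Reach-σ^ S = Star-iter σ (λ _ → inj₁ refl)

  Reach-σ⁻¹ : ∀ S x → Reach S (σ x) x
  Reach-σ⁻¹ S x with k , σ^k ← Orbit.iter-reverse σ-injective 1 refl =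
    subst (Reach S (σ x)) σ^k (Reach-σ^ S k (σ x))

  Reach-mono : ∀ {S S'} → (∀ x → S x ≡ true → S' x ≡ true) → ∀ {u v} → Reach S u v → Reach S' u v
  Reach-mono {S} {S'} S⊆S' = Star-map widen
    where
    widen : ∀ {x y} → UStep M S x y → UStep M S' x y
    widen (inj₁ σ-step)         = inj₁ σ-step
    widen (inj₂ (Sx , α-step)) = inj₂ (S⊆S' _ Sx , α-step)

  Connected-resp : ∀ {S S'} → S ≗ S' → Connected M S → Connected M S'
  Connected-resp eq conn y = Reach-mono (λ x Sx → trans (sym (eq x)) Sx) (conn y)

  IsSpanningTree-resp : ∀ {S S'} → S ≗ S' → IsSpanningTree M S → IsSpanningTree M S'
  IsSpanningTree-resp eq (sub , conn , minimal) =
      (λ h → trans (sym (eq (α h))) (trans (sub h) (eq h)))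
    , Connected-resp eq conn
    , λ e S'e conn' → minimal e (trans (eq e) S'e) (Connected-resp (removeE-cong e (sym ∘ eq)) conn')

  Connected-induction : ∀ {S} (P : Fin n → Set) → P h₀ → (∀ {x} → P x → P (σ x)) →
                        (∀ {x} → S x ≡ true → P x → P (α x)) → Connected M S → ∀ y → P y
  Connected-induction {S} P P-h₀ P-σ P-α conn y = Star-preserves step (conn y) P-h₀
    where
    step : P Respects UStep M S
    step (inj₁ refl)        = P-σ
    step (inj₂ (Sx , refl)) = P-α Sx

module TreeTour {n : ℕ} (M : RootedMap n) {T : Fin n → Bool} (tree : IsSpanningTree M T) where
  open RootedMap M
  open MapBasics M

  T-subgraph : IsSubgraph M T
  T-subgraph = proj₁ tree

  T-connected : Connected M T
  T-connected = proj₁ (proj₂ tree)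

  T-minimal : ∀ e → T e ≡ true → ¬ Connected M (removeE M T e)
  T-minimal = proj₂ (proj₂ tree)

  t : Fin n → Fin n
  t = motion M T

  motion-internal : ∀ {x} → T x ≡ true → t x ≡ σ (α x)
  motion-internal {x} Tx = cong (if_then σ (α x) else σ x) Tx

  motion-external : ∀ {x} → T x ≡ false → t x ≡ σ x
  motion-external {x} Tx = cong (if_then σ (α x) else σ x) Tx

  motion-injective : ∀ {x y} → t x ≡ t y → x ≡ y
  motion-injective {x} {y} eq with T x in Tx | T y in Ty
  ... | true  | true  = α-injective (σ-injective eq)
  ... | false | false = σ-injective eq
  ... | true  | false = contradiction (trans (sym Tx) (trans (sym (T-subgraph x)) (trans (cong T (σ-injective eq)) Ty))) λ ()
  ... | false | true  = contradiction (trans (sym Tx) (trans (cong T (σ-injective eq)) (trans (T-subgraph y) Ty))) λ ()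

  internal-off-edge : ∀ {x e} → ¬ SameEdge x e → T x ≡ true → removeE M T e x ≡ true
  internal-off-edge x≁e Tx = trans (removeE-off T x≁e) Tx

  ReachAvoiding : Fin n → Fin n → Set
  ReachAvoiding e = Reach (removeE M T e) h₀

  motion-avoiding : ∀ {e x} → ¬ SameEdge x e → Reach (removeE M T e) x (t x)
  motion-avoiding {x = x} x≁e with T x in Tx
  ... | true  = inj₂ (internal-off-edge x≁e Tx , refl) ◅ inj₁ refl ◅ ε
  ... | false = inj₁ refl ◅ ε

  avoiding-motion⁻¹ : ∀ {e x} → ¬ SameEdge x e → ReachAvoiding e (t x) → ReachAvoiding e x
  avoiding-motion⁻¹ {x = x} x≁e r with T x in Tx
  ... | true  = r ◅◅ Reach-σ⁻¹ _ (α x) ◅◅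
                inj₂ (internal-off-edge (x≁e ∘ SameEdge-α⁻¹) (trans (T-subgraph x) Tx) , sym (α-inv x)) ◅ ε
  ... | false = r ◅◅ Reach-σ⁻¹ _ x

  avoiding-all : ∀ {e} → (ReachAvoiding e e → ReachAvoiding e (α e)) →
                 (ReachAvoiding e (α e) → ReachAvoiding e e) → ∀ y → ReachAvoiding e y
  avoiding-all {e} e⇒αe αe⇒e =
    Connected-induction (ReachAvoiding e) ε (λ r → r ◅◅ inj₁ refl ◅ ε) step T-connected
    where
    step : ∀ {x} → T x ≡ true → ReachAvoiding e x → ReachAvoiding e (α x)
    step {x} Tx r with SameEdge? x e
    ... | yes (inj₁ refl) = e⇒αe r
    ... | yes (inj₂ refl) = subst (ReachAvoiding e) (sym (α-inv e)) (αe⇒e r)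
    ... | no x≁e          = r ◅◅ inj₂ (internal-off-edge x≁e Tx , refl) ◅ ε

  not-both-ends-avoiding : ∀ {e} → T e ≡ true → ReachAvoiding e e → ReachAvoiding e (α e) → ⊥
  not-both-ends-avoiding {e} Te re rαe = T-minimal e Te (avoiding-all (λ _ → rαe) (λ _ → re))

  some-end-avoiding : ∀ {e} → ¬ ReachAvoiding e e → ¬ ReachAvoiding e (α e) → ⊥
  some-end-avoiding {e} ¬re ¬rαe =
    ¬re (avoiding-all (λ re → contradiction re ¬re) (λ rαe → contradiction rαe ¬rαe) e)

  open Orbit motion-injective

  orbit-until-α : (X : Fin n → Set) {e : Fin n} → X (t e) → (∀ {x} → X x → x ≢ α e → X (t x)) →
                  ∀ m → (∃ λ j → iter t j e ≡ α e) ⊎ X (iter t (suc m) e)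
  orbit-until-α X X-te step zero = inj₂ X-te
  orbit-until-α X {e} X-te step (suc m) with orbit-until-α X X-te step m
  ... | inj₁ found = inj₁ found
  ... | inj₂ X-m with iter t (suc m) e ≟ α e
  ...   | yes hit = inj₁ (suc m , hit)
  ...   | no miss = inj₂ (step X-m miss)

  orbit-meets-α : (X : Fin n → Set) {e : Fin n} → X (t e) → ¬ X e →
                  (∀ {x} → X x → x ≢ α e → X (t x)) → ∃ λ j → iter t j e ≡ α e
  orbit-meets-α X {e} X-te ¬X-e step
    with p , _ , cyc ← period e
    with orbit-until-α X X-te step p
  ... | inj₁ found = found
  ... | inj₂ X-e   = contradiction (subst X cyc X-e) ¬X-e

  crossing-if-reachable : ∀ {e} → T e ≡ true → ReachAvoiding e e → ∃ λ j → iter t j e ≡ α e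
  crossing-if-reachable {e} Te re = orbit-meets-α (¬_ ∘ ReachAvoiding e) ¬r-te (λ ¬re → ¬re re) step
    where
    ¬r-te : ¬ ReachAvoiding e (t e)
    ¬r-te r = not-both-ends-avoiding Te re (subst (ReachAvoiding e) (motion-internal Te) r ◅◅ Reach-σ⁻¹ _ (α e))
    step : ∀ {x} → ¬ ReachAvoiding e x → x ≢ α e → ¬ ReachAvoiding e (t x)
    step ¬rx x≢αe = ¬rx ∘ avoiding-motion⁻¹ λ where
      (inj₁ refl) → ¬rx re
      (inj₂ x≡αe) → x≢αe x≡αe

  crossing-if-unreachable : ∀ {e} → T e ≡ true → ¬ ReachAvoiding e e → ReachAvoiding e (α e) →
                            ∃ λ j → iter t j e ≡ α e
  crossing-if-unreachable {e} Te ¬re rαe = orbit-meets-α (ReachAvoiding e) r-te ¬re step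
    where
    r-te : ReachAvoiding e (t e)
    r-te = subst (ReachAvoiding e) (sym (motion-internal Te)) (rαe ◅◅ inj₁ refl ◅ ε)
    step : ∀ {x} → ReachAvoiding e x → x ≢ α e → ReachAvoiding e (t x)
    step rx x≢αe = rx ◅◅ motion-avoiding λ where
      (inj₁ refl) → ¬re rx
      (inj₂ x≡αe) → x≢αe x≡αe

  -- Reachability avoiding e is not known to be decidable, so the case split on it happens
  -- under a double negation, which the bounded (hence decidable) search then discharges.
  tour-crosses-edge : ∀ {e} → T e ≡ true → ∃ λ j → iter t j e ≡ α e
  tour-crosses-edge {e} Te = unbound (decidable-stable found? ¬¬found)
    where
    Found : Set
    Found = ∃ λ (i : Fin n) → iter t (toℕ i) e ≡ α e

    found? : Dec Found
    found? = any? λ i → iter t (toℕ i) e ≟ α e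

    bound : (∃ λ j → iter t j e ≡ α e) → Found
    bound (j , eq) with k , k<n , eq' ← iter-bounded j eq =
      fromℕ< k<n , trans (cong (λ m → iter t m e) (toℕ-fromℕ< k<n)) eq'

    unbound : Found → ∃ λ j → iter t j e ≡ α e
    unbound (i , eq) = toℕ i , eq

    ¬¬found : ¬ ¬ Found
    ¬¬found ¬found = ¬¬-excluded-middle {A = ReachAvoiding e e} λ where
      (yes re) → ¬found (bound (crossing-if-reachable Te re))
      (no ¬re) → ¬¬-excluded-middle {A = ReachAvoiding e (α e)} λ where
        (yes rαe) → ¬found (bound (crossing-if-unreachable Te ¬re rαe))
        (no ¬rαe) → some-end-avoiding ¬re ¬rαe

  OnTour : Fin n → Set
  OnTour h = ∃ λ k → iter t k h₀ ≡ h

  on-tour-α : ∀ {x} → T x ≡ true → OnTour x → OnTour (α x)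
  on-tour-α {x} Tx (k , eq) = j + k , (begin
    iter t (j + k) h₀          ≡⟨ iter-+ t j k h₀ ⟩
    iter t j (iter t k h₀)     ≡⟨ cong (iter t j) eq ⟩
    iter t j x                 ≡⟨ proj₂ crossing ⟩
    α x                        ∎)
    where
    crossing : ∃ λ j → iter t j x ≡ α x
    crossing = tour-crosses-edge Tx
    j : ℕ
    j = proj₁ crossing

  on-tour-σ : ∀ {x} → OnTour x → OnTour (σ x)
  on-tour-σ {x} (k , eq) with T x in Tx
  ... | false = suc k , trans (cong t eq) (motion-external Tx)
  ... | true  = suc (proj₁ on-αx) ,
                trans (cong t (proj₂ on-αx)) (trans (motion-internal (trans (T-subgraph x) Tx)) (cong σ (α-inv x)))
    where
    on-αx : OnTour (α x)
    on-αx = on-tour-α Tx (k , eq)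

  tour-covers : ∀ h → OnTour h
  tour-covers = Connected-induction OnTour (0 , refl) on-tour-σ on-tour-α T-connected

  open Enumeration h₀ tour-covers public using (index; index<n; iter-index; index-iter; index-injective)

  Before⇒index< : ∀ {h h'} → Before M T h h' → index h < index h'
  Before⇒index< (k , k' , k<k' , k'<n , refl , refl) =
    subst₂ _<_ (sym (index-iter (<-trans k<k' k'<n))) (sym (index-iter k'<n)) k<k'

  index<⇒Before : ∀ {h h'} → index h < index h' → Before M T h h'
  index<⇒Before {h} {h'} lt = index h , index h' , lt , index<n h' , iter-index h , iter-index h'

  tour-segment : ∀ e {i j} → i ≤ j → j ≤ n →
                 (index e < i ⊎ j ≤ index e) → (index (α e) < i ⊎ j ≤ index (α e)) →
                 Reach (removeE M T e) (iter t i h₀) (iter t j h₀)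
  tour-segment e {j = zero} z≤n _ _ _ = ε
  tour-segment e {i} {suc j} i≤1+j j<n out out-α with m≤n⇒m<n∨m≡n i≤1+j
  ... | inj₂ refl   = ε
  ... | inj₁ i<1+j  =
    tour-segment e (≤-pred i<1+j) (<⇒≤ j<n) (shrink out) (shrink out-α) ◅◅ motion-avoiding off
    where
    shrink : ∀ {k} → k < i ⊎ suc j ≤ k → k < i ⊎ j ≤ k
    shrink = map₂ (≤-trans (n≤1+n j))
    misses : ∀ {k} → k < i ⊎ suc j ≤ k → j ≢ k
    misses (inj₁ k<i)   refl = <-irrefl refl (<-≤-trans k<i (≤-pred i<1+j))
    misses (inj₂ 1+j≤k) refl = <-irrefl refl 1+j≤k
    off : ¬ SameEdge (iter t j h₀) e
    off (inj₁ eq) = misses out   (trans (sym (index-iter j<n)) (cong index eq))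
    off (inj₂ eq) = misses out-α (trans (sym (index-iter j<n)) (cong index eq))

  tour-predecessor : ∀ y → y ≡ h₀ ⊎ ∃ λ x → t x ≡ y × index x < index y
  tour-predecessor y = by-index (index y) refl
    where
    by-index : ∀ k → index y ≡ k → y ≡ h₀ ⊎ ∃ λ x → t x ≡ y × index x < index y
    by-index zero    iy = inj₁ (trans (sym (iter-index y)) (cong (λ m → iter t m h₀) iy))
    by-index (suc k) iy = inj₂ (iter t k h₀ , trans (cong (λ m → iter t m h₀) (sym iy)) (iter-index y)
                               , subst (_< index y) (sym (index-iter k<n)) (subst (k <_) (sym iy) ≤-refl))
      where
      k<n : k < n
      k<n = <-trans (n<1+n k) (subst (_< n) iy (index<n y))

module TreeCuts {n : ℕ} (M : RootedMap n) {T : Fin n → Bool} (tree : IsSpanningTree M T) where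
  open RootedMap M
  open MapBasics M
  open TreeTour M tree

  first-half : ∀ e → ∃ λ a → SameEdge a e × index a < index (α a)
  first-half e with <-cmp (index e) (index (α e))
  ... | tri< e<αe _ _ = e , inj₁ refl , e<αe
  ... | tri≈ _ e≡αe _ = contradiction (sym (index-injective e≡αe)) (α-fpf e)
  ... | tri> _ _ αe<e = α e , inj₂ refl , subst (λ z → index (α e) < index z) (sym (α-inv e)) αe<e

  first-half-least : ∀ {b e w} → SameEdge b e → index b < index (α b) → SameEdge w e → index b ≤ index w
  first-half-least b~e b<αb w~e with SameEdge-trans w~e (SameEdge-sym b~e)
  ... | inj₁ refl = ≤-refl
  ... | inj₂ refl = <⇒≤ b<αb

  precedes⇒EdgeLess : ∀ {z e' e} → SameEdge z e' → index z < index e → index z < index (α e) → EdgeLess M T e' e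
  precedes⇒EdgeLess z~e' z<e z<αe = _ , z~e' , index<⇒Before z<e , index<⇒Before z<αe

  Downward : Fin n → Set
  Downward a = T a ≡ true × index a < index (α a)

  Below : Fin n → Fin n → Set
  Below a y = index a < index y × index y ≤ index (α a)

  Below? : ∀ a y → Dec (Below a y)
  Below? a y = (index a <? index y) ×-dec (index y ≤? index (α a))

  opaque
    below : Fin n → Fin n → Bool
    below a y = does (Below? a y)

    below-true : ∀ {a y} → below a y ≡ true → Below a y
    below-true {a} {y} p = invert (subst (Reflects (Below a y)) p (proof (Below? a y)))

    below-false : ∀ {a y} → below a y ≡ false → ¬ Below a y
    below-false {a} {y} p = invert (subst (Reflects (Below a y)) p (proof (Below? a y)))

    Below⇒below : ∀ {a y} → Below a y → below a y ≡ true
    Below⇒below {a} {y} = dec-true (Below? a y)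

    ¬Below⇒below : ∀ {a y} → ¬ Below a y → below a y ≡ false
    ¬Below⇒below {a} {y} = dec-false (Below? a y)

  Crosses : Fin n → Fin n → Set
  Crosses a g = below a g ≢ below a (α g)

  Crosses-edge : ∀ {a g x} → Crosses a g → SameEdge x g → Crosses a x
  Crosses-edge cr (inj₁ refl) = cr
  Crosses-edge {a} {g} cr (inj₂ refl) eq = cr (sym (trans eq (cong (below a) (α-inv g))))

  below-α-crossing : ∀ {a g x} → Crosses a g → SameEdge x g → below a (α x) ≡ not (below a x)
  below-α-crossing cr x~g = ¬-not (≢-sym (Crosses-edge cr x~g))

  below-α-noncrossing : ∀ {a g x} → below a g ≡ below a (α g) → SameEdge x g → below a (α x) ≡ below a x
  below-α-noncrossing same (inj₁ refl) = sym same
  below-α-noncrossing {a} {g} same (inj₂ refl) = trans (cong (below a) (α-inv g)) same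

  downward-same-edge : ∀ {a b} → Downward a → Downward b → SameEdge a b → a ≡ b
  downward-same-edge _ _ (inj₁ a≡b) = a≡b
  downward-same-edge {b = b} (_ , αb<ααb) (_ , b<αb) (inj₂ refl) =
    contradiction (subst (λ z → index (α b) < index z) (α-inv b) αb<ααb) (<-asym b<αb)

  SameVertex : Fin n → Fin n → Set
  SameVertex u v = ∃ λ k → iter σ k u ≡ v

  SameVertex-σ : ∀ {u v} → SameVertex u v → SameVertex u (σ v)
  SameVertex-σ (k , eq) = suc k , cong σ eq

  Entry : Fin n → Set
  Entry y = SameVertex h₀ y ⊎ ∃ λ c → Downward c × index c < index y × SameVertex (α c) y

  Entry-σ : ∀ {x y} → Entry x → index x < index y → y ≡ σ x → Entry y
  Entry-σ (inj₁ sv) x<y refl = inj₁ (SameVertex-σ sv)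
  Entry-σ (inj₂ (c , down , c<x , sv)) x<y refl = inj₂ (c , down , <-trans c<x x<y , SameVertex-σ sv)

  entering-edge-bounded : ∀ m y → index y < m → Entry y
  entering-edge-bounded (suc m) y y<1+m with tour-predecessor y
  ... | inj₁ refl = inj₁ (0 , refl)
  ... | inj₂ (x , refl , x<y) with T x ≟ᵇ true
  ...   | no ¬Tx = Entry-σ (entering-edge-bounded m x (<-≤-trans x<y (≤-pred y<1+m))) x<y (motion-external (¬-not ¬Tx))
  ...   | yes Tx with <-cmp (index x) (index (α x))
  ...     | tri< x<αx _ _ = inj₂ (x , (Tx , x<αx) , x<y , 1 , sym (motion-internal Tx))
  ...     | tri≈ _ x≡αx _ = contradiction (sym (index-injective x≡αx)) (α-fpf x)
  ...     | tri> _ _ αx<x = Entry-σ (entering-edge-bounded m (α x) (<-≤-trans (<-trans αx<x x<y) (≤-pred y<1+m)))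
                                    (<-trans αx<x x<y) (motion-internal Tx)

  entering-edge : ∀ y → Entry y
  entering-edge y = entering-edge-bounded (suc (index y)) y ≤-refl

  keeps-downward⇒contains-tree : ∀ {S} → IsSubgraph M S → (∀ {a} → Downward a → S a ≢ false) →
                                 ∀ e → T e ≡ true → S e ≡ true
  keeps-downward⇒contains-tree S-subgraph kept e Te with a , a~e , a<αa ← first-half e =
    ¬-not λ Se → kept (trans (subgraph-on-edge T-subgraph a~e) Te , a<αa) (trans (subgraph-on-edge S-subgraph a~e) Se)

  module Cut {a : Fin n} (down : Downward a) where

    a-internal : T a ≡ true
    a-internal = proj₁ down

    a<αa : index a < index (α a)
    a<αa = proj₂ down

    below⇒reach-α : ∀ {y} → Below a y → Reach (removeE M T a) y (α a)
    below⇒reach-α {y} (a<y , y≤αa) = subst₂ (Reach (removeE M T a)) (iter-index y) (iter-index (α a))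
      (tour-segment a y≤αa (<⇒≤ (index<n _)) (inj₁ a<y) (inj₂ ≤-refl))

    reach-below : ∀ {y} → Below a y → Reach (removeE M T a) (α a) y
    reach-below {y} (a<y , y≤αa) = inj₁ refl ◅ subst₂ (Reach (removeE M T a)) t-a (iter-index y)
      (tour-segment a a<y (<⇒≤ (index<n _)) (inj₁ ≤-refl) (inj₂ y≤αa))
      where
      t-a : iter t (suc (index a)) h₀ ≡ σ (α a)
      t-a = trans (cong t (iter-index a)) (motion-internal a-internal)

    ¬below⇒reachable : ∀ {y} → ¬ Below a y → ReachAvoiding a y
    ¬below⇒reachable {y} ¬b with index a <? index y
    ... | no ¬a<y = subst (ReachAvoiding a) (iter-index y)
      (tour-segment a z≤n (<⇒≤ (index<n y)) (inj₂ (≮⇒≥ ¬a<y)) (inj₂ (≤-trans (≮⇒≥ ¬a<y) (<⇒≤ a<αa))))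
    ... | yes a<y = subst (ReachAvoiding a) (iter-index y) (to-a ◅◅ inj₁ refl ◅ subst (λ z → Reach _ z _) t-αa from-αa)
      where
      αa<y : index (α a) < index y
      αa<y = ≰⇒> λ y≤αa → ¬b (a<y , y≤αa)
      to-a : ReachAvoiding a a
      to-a = subst (ReachAvoiding a) (iter-index a)
        (tour-segment a z≤n (<⇒≤ (index<n a)) (inj₂ ≤-refl) (inj₂ (<⇒≤ a<αa)))
      t-αa : iter t (suc (index (α a))) h₀ ≡ σ a
      t-αa = trans (cong t (iter-index (α a)))
                   (trans (motion-internal (trans (T-subgraph a) a-internal)) (cong σ (α-inv a)))
      from-αa : Reach (removeE M T a) (iter t (suc (index (α a))) h₀) (iter t (index y) h₀)
      from-αa = tour-segment a αa<y (<⇒≤ (index<n y)) (inj₁ (<-trans a<αa (n<1+n _))) (inj₁ (n<1+n _))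

    below⇒unreachable : ∀ {y} → Below a y → ¬ ReachAvoiding a y
    below⇒unreachable b r =
      not-both-ends-avoiding a-internal (¬below⇒reachable λ (a<a , _) → <-irrefl refl a<a) (r ◅◅ below⇒reach-α b)

    below-resp-reach : ∀ {x y} → (ReachAvoiding a x → ReachAvoiding a y) → (ReachAvoiding a y → ReachAvoiding a x) →
                 below a x ≡ below a y
    below-resp-reach {x} {y} x⇒y y⇒x with below a x in bx | below a y in by
    ... | true  | true  = refl
    ... | false | false = refl
    ... | true  | false = contradiction (y⇒x (¬below⇒reachable (below-false by))) (below⇒unreachable (below-true bx))
    ... | false | true  = contradiction (x⇒y (¬below⇒reachable (below-false bx))) (below⇒unreachable (below-true by))

    below-σ : ∀ x → below a (σ x) ≡ below a x
    below-σ x = below-resp-reach (λ r → r ◅◅ Reach-σ⁻¹ _ x) (λ r → r ◅◅ inj₁ refl ◅ ε)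

    below-σ^ : ∀ k x → below a (iter σ k x) ≡ below a x
    below-σ^ zero    x = refl
    below-σ^ (suc k) x = trans (below-σ (iter σ k x)) (below-σ^ k x)

    below-α : ∀ {x} → T x ≡ true → ¬ SameEdge x a → below a (α x) ≡ below a x
    below-α {x} Tx x≁a = below-resp-reach
      (λ r → r ◅◅ inj₂ (internal-off-edge (x≁a ∘ SameEdge-α⁻¹) (trans (T-subgraph x) Tx) , sym (α-inv x)) ◅ ε)
      (λ r → r ◅◅ inj₂ (internal-off-edge x≁a Tx , refl) ◅ ε)

    below-root : below a h₀ ≡ false
    below-root = ¬Below⇒below λ b → below⇒unreachable b ε

    below-αa : below a (α a) ≡ true
    below-αa = Below⇒below (a<αa , ≤-refl)

    cut-disconnects : ∀ {S} → (∀ x → S x ≡ true → below a (α x) ≡ below a x) → ¬ Connected M S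
    cut-disconnects preserves conn = contradiction
      (trans (sym below-αa) (Connected-induction (λ y → below a y ≡ false) below-root
         (λ {x} p → trans (below-σ x) p) (λ {x} Sx p → trans (preserves x Sx) p) conn (α a))) λ ()

  two-cuts-disconnect : ∀ {a b} → Downward a → Downward b → a ≢ b → ∀ {S} →
                        (∀ x → S x ≡ true → below a x ≡ below b x → below a (α x) ≡ below b (α x)) →
                        ¬ Connected M S
  two-cuts-disconnect {a} {b} down-a down-b a≢b preserves conn =
    a≢b (α-injective (index-injective (≤-antisym (proj₂ (below-true αa-below-b)) (proj₂ (below-true αb-below-a)))))
    where
    agree : ∀ y → below a y ≡ below b y
    agree = Connected-induction (λ y → below a y ≡ below b y)
      (trans (Cut.below-root down-a) (sym (Cut.below-root down-b)))
      (λ {x} p → trans (Cut.below-σ down-a x) (trans p (sym (Cut.below-σ down-b x))))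
      (λ {x} Sx → preserves x Sx) conn
    αa-below-b : below b (α a) ≡ true
    αa-below-b = trans (sym (agree (α a))) (Cut.below-αa down-a)
    αb-below-a : below a (α b) ≡ true
    αb-below-a = trans (agree (α b)) (Cut.below-αa down-b)

module FundamentalCocycles {n : ℕ} (M : RootedMap n) {T : Fin n → Bool} (tree : IsSpanningTree M T) where
  open RootedMap M
  open MapBasics M
  open TreeTour M tree
  open TreeCuts M tree

  external-off-internal : ∀ {g a} → T g ≡ false → T a ≡ true → ¬ SameEdge g a
  external-off-internal Tg Ta g~a = contradiction (trans (sym Tg) (trans (subgraph-on-edge T-subgraph g~a) Ta)) λ ()

  crossing-end : ∀ {a g} → Crosses a g → ∃ λ z → SameEdge z g × below a z ≡ false × below a (α z) ≡ true
  crossing-end {a} {g} cr = by-side (below a g) refl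
    where
    flipped : below a (α g) ≡ not (below a g)
    flipped = ¬-not (≢-sym cr)
    by-side : ∀ b → below a g ≡ b → ∃ λ z → SameEdge z g × below a z ≡ false × below a (α z) ≡ true
    by-side false bg = g , inj₁ refl , bg , trans flipped (cong not bg)
    by-side true  bg = α g , inj₂ refl , trans flipped (cong not bg) , trans (cong (below a) (α-inv g)) bg

  module Exchange {a g : Fin n} (down : Downward a) (Tg : T g ≡ false) (cr : Crosses a g) where
    open Cut down

    T' : Fin n → Bool
    T' = addE M (removeE M T a) g

    lift : ∀ {u v} → Reach (removeE M T a) u v → Reach T' u v
    lift = Reach-mono (addE-⊇ (removeE M T a) g)

    T'-connected : Connected M T'
    T'-connected y with below a y in by
    ... | false = lift (¬below⇒reachable (below-false by))
    ... | true with z , z~g , z-above , αz-below ← crossing-end cr =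
      lift (¬below⇒reachable (below-false z-above)) ◅◅
      inj₂ (addE-on (removeE M T a) z~g , refl) ◅ lift (below⇒reach-α (below-true αz-below) ◅◅ reach-below (below-true by))

    T'-edge : ∀ {c x} → removeE M T' c x ≡ true → ¬ SameEdge x c × (SameEdge x g ⊎ (¬ SameEdge x a × T x ≡ true))
    T'-edge p with x≁c , T'x ← removeE-true T' p with addE-true (removeE M T a) T'x
    ... | inj₁ x~g = x≁c , inj₁ x~g
    ... | inj₂ r   = x≁c , inj₂ (removeE-true T r)

    -- If g does not cross the cut of b, that cut separates T' − c; if it does, g is the only
    -- edge of T' − c crossing either of the cuts of a and b, which forces them to coincide.
    other-edge-essential : ∀ {b c} → Downward b → SameEdge b c → ¬ SameEdge c a → ¬ Connected M (removeE M T' c)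
    other-edge-essential {b} {c} down-b b~c c≁a conn with below b g ≟ᵇ below b (α g)
    ... | yes same = Cut.cut-disconnects down-b preserves conn
      where
      preserves : ∀ x → removeE M T' c x ≡ true → below b (α x) ≡ below b x
      preserves x p with T'-edge p
      ... | x≁c , inj₁ x~g         = below-α-noncrossing same x~g
      ... | x≁c , inj₂ (x≁a , Tx) = Cut.below-α down-b Tx (x≁c ∘ λ x~b → SameEdge-trans x~b b~c)
    ... | no cr-b = two-cuts-disconnect down down-b a≢b preserves conn
      where
      a≢b : a ≢ b
      a≢b refl = c≁a (SameEdge-sym b~c)
      preserves : ∀ x → removeE M T' c x ≡ true → below a x ≡ below b x → below a (α x) ≡ below b (α x)
      preserves x p agree with T'-edge p
      ... | x≁c , inj₁ x~g         =
        trans (below-α-crossing cr x~g) (trans (cong not agree) (sym (below-α-crossing cr-b x~g)))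
      ... | x≁c , inj₂ (x≁a , Tx) =
        trans (below-α Tx x≁a) (trans agree (sym (Cut.below-α down-b Tx (x≁c ∘ λ x~b → SameEdge-trans x~b b~c))))

    T'-minimal : ∀ c → T' c ≡ true → ¬ Connected M (removeE M T' c)
    T'-minimal c T'c conn with SameEdge? c g
    ... | yes c~g = T-minimal a a-internal (Connected-resp T'-c≗T-a conn)
      where
      T'-c≗T-a : removeE M T' c ≗ removeE M T a
      T'-c≗T-a x = trans (removeE-edge-cong T' c~g x)
        (removeE-addE (removeE-subgraph a T-subgraph) (trans (removeE-off T (external-off-internal Tg a-internal)) Tg) x)
    ... | no c≁g with addE-true (removeE M T a) T'c
    ...   | inj₁ c~g = c≁g c~g
    ...   | inj₂ r with c≁a , Tc ← removeE-true T r with b , b~c , b<αb ← first-half c =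
      other-edge-essential (trans (subgraph-on-edge T-subgraph b~c) Tc , b<αb) b~c c≁a conn

    exchange-tree : IsSpanningTree M T'
    exchange-tree = addE-subgraph g (removeE-subgraph a T-subgraph) , T'-connected , T'-minimal

  crossing⇒cocycle : ∀ {a g} → Downward a → T g ≡ false → Crosses a g → InFundCocycle M T a g
  crossing⇒cocycle down Tg cr = Exchange.exchange-tree down Tg cr

  crossing⇒cocycle-α : ∀ {a g} → Downward a → T g ≡ false → Crosses a g → InFundCocycle M T (α a) g
  crossing⇒cocycle-α {a} {g} down Tg cr =
    IsSpanningTree-resp (addE-cong g (removeE-edge-cong T (inj₂ (sym (α-inv a))))) (Exchange.exchange-tree down Tg cr)

  crossing⇒cycle : ∀ {a g} → Downward a → T g ≡ false → Crosses a g → InFundCycle M T g a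
  crossing⇒cycle down Tg cr =
    IsSpanningTree-resp (sym ∘ removeE-addE-comm T (external-off-internal Tg (proj₁ down))) (Exchange.exchange-tree down Tg cr)

  cocycle⇒crossing : ∀ {a g} → Downward a → InFundCocycle M T a g → SameEdge g a ⊎ (T g ≡ false × Crosses a g)
  cocycle⇒crossing {a} {g} down (_ , conn , _) with SameEdge? g a
  ... | yes g~a = inj₁ g~a
  ... | no g≁a with T g ≟ᵇ true
  ...   | yes Tg = contradiction
    (Connected-resp (addE-present (removeE-subgraph a T-subgraph) (internal-off-edge g≁a Tg)) conn)
    (T-minimal a (proj₁ down))
  ...   | no ¬Tg with below a g ≟ᵇ below a (α g)
  ...     | no cr     = inj₂ (¬-not ¬Tg , cr)
  ...     | yes same  = contradiction conn (Cut.cut-disconnects down preserves)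
    where
    preserves : ∀ x → addE M (removeE M T a) g x ≡ true → below a (α x) ≡ below a x
    preserves x p with addE-true (removeE M T a) p
    ... | inj₁ x~g = below-α-noncrossing same x~g
    ... | inj₂ r with x≁a , Tx ← removeE-true T r = Cut.below-α down Tx x≁a

module Orientation {n : ℕ} (M : RootedMap n) {T S : Fin n → Bool} (tree : IsSpanningTree M T)
                   (S-subgraph : IsSubgraph M S) (interval : InInterval M T S) where
  open RootedMap M
  open MapBasics M
  open TreeTour M tree
  open TreeCuts M tree
  open FundamentalCocycles M tree

  ΦReach : Fin n → Set
  ΦReach = Star (ΦStep M T S) h₀

  ΦReach-vertex : ∀ {u v} → SameVertex u v → ΦReach v → ΦReach u
  ΦReach-vertex {u} {v} (k , eq) r = subst ΦReach (proj₂ back) (r ◅◅ Star-iter σ (λ _ → inj₁ refl) (proj₁ back) v)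
    where
    back : ∃ λ k' → iter σ k' v ≡ u
    back = Orbit.iter-reverse σ-injective k eq

  ΦReach-arc : ∀ {x} → ΦTail M T S x → ΦReach x → ΦReach (α x)
  ΦReach-arc tail r = r ◅◅ inj₂ (tail , refl) ◅ ε

  ΦCond⇒unchanged : ∀ {x} → T x ≡ true → ΦCond M T S x → S x ≡ T x
  ΦCond⇒unchanged Tx (inj₁ (_ , unchanged)) = unchanged _ (IsSpanningTree-resp (sym ∘ addE-removeE T-subgraph Tx) tree)
  ΦCond⇒unchanged Tx (inj₂ (¬Tx , _))       = contradiction (trans (sym Tx) ¬Tx) λ ()

  changed⇒ΦCond : ∀ {g} → T g ≡ false → S g ≢ T g → ΦCond M T S g
  changed⇒ΦCond Tg changed = inj₂ (Tg , _ , IsSpanningTree-resp (sym ∘ removeE-addE T-subgraph Tg) tree , changed)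

  ¬ΦCond-crossing : ∀ {c f} → Downward c → T f ≡ false → S f ≢ T f → Crosses c f → ¬ ΦCond M T S (α c)
  ¬ΦCond-crossing down Tf changed cr (inj₁ (_ , unchanged)) = changed (unchanged _ (crossing⇒cocycle-α down Tf cr))
  ¬ΦCond-crossing down Tf changed cr (inj₂ (¬Tαc , _)) =
    contradiction (trans (sym (trans (T-subgraph _) (proj₁ down))) ¬Tαc) λ ()

  active-crossing : ∀ {a x} → Downward a → Active M T a → T x ≡ false → Active M T x → ¬ Crosses a x
  active-crossing {a} {x} down act-a Tx act-x cr with xl , xl~x , xl<αxl ← first-half x
    with <-cmp (index xl) (index a)
  ... | tri< xl<a _ _ = proj₁ act-a (proj₁ down) x (crossing⇒cocycle down Tx cr)
                          (precedes⇒EdgeLess xl~x xl<a (<-trans xl<a (proj₂ down)))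
  ... | tri≈ _ xl≡a _ = contradiction (trans (sym Tx) (trans (sym (subgraph-on-edge T-subgraph xl~x))
                          (trans (cong T (index-injective xl≡a)) (proj₁ down)))) λ ()
  ... | tri> _ _ a<xl = proj₂ act-x Tx a (crossing⇒cycle down Tx cr)
                          (precedes⇒EdgeLess (inj₁ refl) (<-≤-trans a<xl (first-half-least xl~x xl<αxl (inj₁ refl)))
                                                         (<-≤-trans a<xl (first-half-least xl~x xl<αxl (inj₂ refl))))

  module RemovedTreeEdge {a : Fin n} (down : Downward a) (Sa : S a ≡ false) where
    open Cut down

    a-changed : S a ≢ T a
    a-changed eq = contradiction (trans (sym Sa) (trans eq a-internal)) λ ()

    a-active : Active M T a
    a-active = interval a a-changed

    ¬connected : ¬ Connected M S
    ¬connected = cut-disconnects preserves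
      where
      preserves : ∀ x → S x ≡ true → below a (α x) ≡ below a x
      preserves x Sx with T x ≟ᵇ true
      ... | yes Tx = below-α Tx λ x~a → contradiction (trans (sym Sx) (trans (subgraph-on-edge S-subgraph x~a) Sa)) λ ()
      ... | no ¬Tx with below a x ≟ᵇ below a (α x)
      ...   | yes same = sym same
      ...   | no cr    = contradiction cr (active-crossing down a-active (¬-not ¬Tx) (interval x x-changed))
        where
        x-changed : S x ≢ T x
        x-changed eq = ¬Tx (trans (sym eq) Sx)

    internal-arc-stays-above : ∀ {x} → T x ≡ true → ΦTail M T S x → below a x ≡ false → below a (α x) ≡ false
    internal-arc-stays-above {x} Tx tail above with SameEdge? x a
    ... | no x≁a = trans (below-α Tx x≁a) above
    ... | yes x~a with tail
    ...   | inj₁ (_ , cond) =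
      contradiction (trans (sym (trans (subgraph-on-edge S-subgraph x~a) Sa)) (trans (ΦCond⇒unchanged Tx cond) Tx)) λ ()
    ...   | inj₂ (αx-first , _) with x~a
    ...     | inj₁ refl = contradiction (Before⇒index< αx-first) (<-asym a<αa)
    ...     | inj₂ refl = contradiction (trans (sym above) below-αa) λ ()

    external-arc-stays-above : ∀ {x} → T x ≡ false → ΦTail M T S x → below a x ≡ false → below a (α x) ≡ false
    external-arc-stays-above {x} Tx tail above with below a x ≟ᵇ below a (α x)
    ... | yes same = trans (sym same) above
    ... | no cr with tail
    ...   | inj₂ (_ , ¬cond) = contradiction (inj₂ (Tx , a , crossing⇒cycle down Tx cr , a-changed)) ¬cond
    ...   | inj₁ (x-first , _) = contradiction (precedes⇒EdgeLess (inj₁ refl) x<a (<-trans x<a a<αa))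
                                   (proj₁ a-active a-internal x (crossing⇒cocycle down Tx cr))
      where
      αx-below : Below a (α x)
      αx-below = below-true (trans (¬-not (≢-sym cr)) (cong not above))
      x<a : index x < index a
      x<a with <-cmp (index x) (index a)
      ... | tri< x<a _ _ = x<a
      ... | tri≈ _ x≡a _ = contradiction (trans (sym Tx) (trans (cong T (index-injective x≡a)) a-internal)) λ ()
      ... | tri> _ _ a<x = contradiction (a<x , ≤-trans (<⇒≤ (Before⇒index< x-first)) (proj₂ αx-below)) (below-false above)

    ¬Φ-root-connected : ¬ ΦRootConnected M T S
    ¬Φ-root-connected rc = contradiction (trans (sym below-αa) (Star-preserves step (rc (α a)) below-root)) λ ()
      where
      step : (λ y → below a y ≡ false) Respects ΦStep M T S
      step (inj₁ refl) above = trans (below-σ _) above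
      step {x} (inj₂ (tail , refl)) above with T x ≟ᵇ true
      ... | yes Tx = internal-arc-stays-above Tx tail above
      ... | no ¬Tx = external-arc-stays-above (¬-not ¬Tx) tail above

  module ContainsTree (T⊆S : ∀ e → T e ≡ true → S e ≡ true) where

    connected : Connected M S
    connected y = Reach-mono T⊆S (T-connected y)

    module Climb {x fl : Fin n} (down : Downward x) (Tfl : T fl ≡ false) (fl-changed : S fl ≢ T fl)
                 (fl<x : index fl < index x) where

      -- From below x, go up along the tree edges through which the tour first enters each
      -- vertex; the edge of fl crosses each of them, so Φ(S) orients them towards the root.
      climb : ∀ m y → index y < m → Below x y → ΦReach y →
              (∀ c → Downward c → Below c y → Below c (α fl)) → ΦReach (α x)
      climb (suc m) y y<m x-y ry nested with entering-edge y
      ... | inj₁ (k , root-vertex) =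
        contradiction x-y (below-false (trans (sym (cong (below x) root-vertex))
                                              (trans (Cut.below-σ^ down k h₀) (Cut.below-root down))))
      ... | inj₂ (c , down-c , c<y , k , c-vertex) with c ≟ x
      ...   | yes refl = ΦReach-vertex (k , c-vertex) ry
      ...   | no c≢x   = climb m c (<-≤-trans c<y (≤-pred y<m)) x-c rc nested-c
        where
        y-side : ∀ {b} → Downward b → below b y ≡ below b (α c)
        y-side down-b = trans (sym (cong (below _) c-vertex)) (Cut.below-σ^ down-b k (α c))
        x-c : Below x c
        x-c = below-true (trans (sym (Cut.below-α down (proj₁ down-c) (c≢x ∘ downward-same-edge down-c down)))
                                (trans (sym (y-side down)) (Below⇒below x-y)))
        c-y : Below c y
        c-y = below-true (trans (y-side down-c) (Cut.below-αa down-c))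
        c-αfl : Below c (α fl)
        c-αfl = nested c down-c c-y
        crosses : Crosses c fl
        crosses eq = <-asym (proj₁ (below-true (trans eq (Below⇒below c-αfl)))) (<-trans fl<x (proj₁ x-c))
        rc : ΦReach c
        rc = subst ΦReach (α-inv c) (ΦReach-arc
               (inj₂ (index<⇒Before (subst (λ z → index z < index (α c)) (sym (α-inv c)) (proj₂ down-c)) ,
                      ¬ΦCond-crossing down-c Tfl fl-changed crosses))
               (ΦReach-vertex (k , c-vertex) ry))
        nested-c : ∀ c' → Downward c' → Below c' c → Below c' (α fl)
        nested-c c' down-c' c'-c = <-trans (proj₁ c'-c) (proj₁ c-αfl) , ≤-trans (proj₂ c-αfl) (proj₂ c'-αc)
          where
          c'-αc : Below c' (α c)
          c'-αc = below-true (trans (Cut.below-α down-c' (proj₁ down-c) c≁c') (Below⇒below c'-c))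
            where
            c≁c' : ¬ SameEdge c c'
            c≁c' c~c' with downward-same-edge down-c down-c' c~c'
            ... | refl = <-irrefl refl (proj₁ c'-c)

    changed⇒external : ∀ {e} → S e ≢ T e → T e ≡ false
    changed⇒external {e} changed = ¬-not λ Te → changed (trans (T⊆S e Te) (sym Te))

    -- Φ(S) orients x away from the root unless a changed external edge f crosses the cut of x;
    -- f is active, so its first half-edge fl precedes x, and the arc fl → α fl leads below x.
    descend : ∀ {x} → Downward x → (∀ y → index y < index x → ΦReach y) → ΦReach x → ΦReach (α x)
    descend {x} down earlier rx with any? (λ f → ¬? (below x f ≟ᵇ below x (α f)) ×-dec ¬? (S f ≟ᵇ T f))
    ... | no none = ΦReach-arc (inj₁ (index<⇒Before (proj₂ down) , inj₁ (proj₁ down , unchanged))) rx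
      where
      unchanged : ∀ e → InFundCocycle M T x e → S e ≡ T e
      unchanged e coc with cocycle⇒crossing down coc
      ... | inj₁ e~x = trans (subgraph-on-edge S-subgraph e~x)
                         (trans (T⊆S x (proj₁ down)) (sym (trans (subgraph-on-edge T-subgraph e~x) (proj₁ down))))
      ... | inj₂ (_ , cr) = decidable-stable (S e ≟ᵇ T e) λ changed → none (e , cr , changed)
    ... | yes (f , cr , changed) with fl , fl~f , fl<αfl ← first-half f with <-cmp (index fl) (index x)
    ...   | tri< fl<x _ _ =
      Climb.climb down Tfl fl-changed fl<x (suc (index (α fl))) (α fl) ≤-refl x-αfl rαfl λ _ _ c-αfl → c-αfl
      where
      Tfl : T fl ≡ false
      Tfl = trans (subgraph-on-edge T-subgraph fl~f) (changed⇒external changed)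
      fl-changed : S fl ≢ T fl
      fl-changed eq = changed (trans (sym (subgraph-on-edge S-subgraph fl~f)) (trans eq (subgraph-on-edge T-subgraph fl~f)))
      x-αfl : Below x (α fl)
      x-αfl = below-true (trans (below-α-crossing cr fl~f) (cong not (¬Below⇒below λ x-fl → <-asym fl<x (proj₁ x-fl))))
      rαfl : ΦReach (α fl)
      rαfl = ΦReach-arc (inj₁ (index<⇒Before fl<αfl , changed⇒ΦCond Tfl fl-changed)) (earlier fl fl<x)
    ...   | tri≈ _ fl≡x _ = contradiction (trans (sym (proj₁ down)) (trans (cong T (index-injective (sym fl≡x)))
                              (trans (subgraph-on-edge T-subgraph fl~f) (changed⇒external changed)))) λ ()
    ...   | tri> _ _ x<fl = contradiction
      (precedes⇒EdgeLess (inj₁ refl) (<-≤-trans x<fl (first-half-least fl~f fl<αfl (inj₁ refl)))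
                                     (<-≤-trans x<fl (first-half-least fl~f fl<αfl (inj₂ refl))))
      (proj₂ (interval f changed) (changed⇒external changed) x (crossing⇒cycle down (changed⇒external changed) cr))

    ΦReach-motion : ∀ {x} → (∀ y → index y < index x → ΦReach y) → ΦReach x → ΦReach (t x)
    ΦReach-motion {x} earlier rx with T x ≟ᵇ true
    ... | no ¬Tx = rx ◅◅ inj₁ (motion-external (¬-not ¬Tx)) ◅ ε
    ... | yes Tx = αx-reached ◅◅ inj₁ (motion-internal Tx) ◅ ε
      where
      αx-reached : ΦReach (α x)
      αx-reached with <-cmp (index x) (index (α x))
      ... | tri< x<αx _ _ = descend (Tx , x<αx) earlier rx
      ... | tri≈ _ x≡αx _ = contradiction (sym (index-injective x≡αx)) (α-fpf x)
      ... | tri> _ _ αx<x = earlier (α x) αx<x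

    reach-bounded : ∀ m y → index y < m → ΦReach y
    reach-bounded (suc m) y y<m with tour-predecessor y
    ... | inj₁ refl = ε
    ... | inj₂ (x , refl , x<y) = ΦReach-motion
      (λ z z<x → reach-bounded m z (<-≤-trans (<-trans z<x x<y) (≤-pred y<m)))
      (reach-bounded m x (<-≤-trans x<y (≤-pred y<m)))

    Φ-root-connected : ΦRootConnected M T S
    Φ-root-connected y = reach-bounded (suc (index y)) y ≤-refl

proposition30 : ∀ {n : ℕ} (M : RootedMap n) (T S : Fin n → Bool) →
    IsSpanningTree M T → IsSubgraph M S → InInterval M T S →
    (ΦRootConnected M T S ⇔ Connected M S)
proposition30 M T S tree S-subgraph interval = mk⇔
  (λ rc → ContainsTree.connected
            (keeps-downward⇒contains-tree S-subgraph λ down Sa → RemovedTreeEdge.¬Φ-root-connected down Sa rc))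
  (λ conn → ContainsTree.Φ-root-connected
              (keeps-downward⇒contains-tree S-subgraph λ down Sa → RemovedTreeEdge.¬connected down Sa conn))
  where
  open TreeCuts M tree using (keeps-downward⇒contains-tree)
  open Orientation M tree S-subgraph interval
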